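{- Let $D$ be the diagram of a skew shape with no empty rows or columns, and suppose $D$ contains none of the following diagrams as a subdiagram: (a) $\{(1,2),(1,3),(2,1),(2,2)\}$; (b) $\{(1,2),(2,1),(2,2),(3,1)\}$; (c) $\{(1,3),(2,1),(2,2),(3,1)\}$; (d) $\{(1,2),(1,3),(2,2),(3,1)\}$; (e) $\{(1,3),(2,2),(3,1),(3,2)\}$; (f) $\{(1,3),(2,2),(2,3),(3,1)\}$; (g) $\{(1,2),(2,2),(3,1),(4,1)\}$; and, for every $r\ge4$: (h) $\{(1,3),(2,2)\}\cup\{(i,1):3\le i\le r\}$; (i) $\{(1,3)\}\cup\{(i,2):2\le i\le r-1\}\cup\{(r,1)\}$; (j) $\{(i,3):1\le i\le r-2\}\cup\{(r-1,2),(r,1)\}$. Then $D$ is either a disjoint union of rows (no column contains two boxes), or one of: the $2\times2$ box $\{(1,1),(1,2),(2,1),(2,2)\}$; a hook $\{(1,j):2\le j\le h\}\cup\{(i,1):2\le i\le l\}$ ($h,l\ge1$), possibly together with the box $(1,1)$; a reverse hook $\{(i,c):1\le i\le l-1\}\cup\{(l,j):1\le j\le c-1\}$ ($c,l\ge1$), possibly together with the box $(l,c)$.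
   Context: The diagram of a skew shape $\lambda/\mu$ (partitions with $\lambda_i\ge\mu_i$) is $\{(i,j)\in\mathbb{Z}^2:\mu_i<j\le\lambda_i\}$, with $i$ the row (increasing downward) and $j$ the column. It has no empty rows or columns if every row $1\le i\le\ell(\lambda)$ and every column $1\le j\le\lambda_1$ contains a box. A diagram $D_1$ is a subdiagram of $D_2$ if $D_1$ is obtained from some subset $S\subseteq D_2$ by deleting empty rows and columns, i.e. by relabelling the rows occupied by $S$ and the columns occupied by $S$ order-preservingly as $1,2,3,\dots$. -}

module Defs where

open import Data.Nat using (ℕ; zero; suc; _+_; _∸_; _≤_; _<_; _≤?_; _≟_)
open import Data.Product using (_×_; _,_; proj₁; proj₂; Σ; ∃)
open import Data.Sum using (_⊎_)
open import Data.List using (List; []; _∷_; map; length; filter; deduplicate; upTo)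
open import Data.List.Relation.Unary.All using (All)
open import Data.List.Membership.Propositional using (_∈_)
open import Relation.Binary.PropositionalEquality using (_≡_)

-- A box (i , j): i = row (increasing downward), j = column; both 1-based.
Cell : Set
Cell = ℕ × ℕ

Diagram : Set₁
Diagram = Cell → Set

-- 1-based parts of a list, padded with zeros: part l 0 = 0, part l i = l_i.
part : List ℕ → ℕ → ℕ
part l zero = zero
part [] (suc i) = zero
part (x ∷ l) (suc zero) = x
part (x ∷ l) (suc (suc i)) = part l (suc i)

IsPartition : List ℕ → Set
IsPartition l = All (λ x → 0 < x) l × (∀ i → part l (suc (suc i)) ≤ part l (suc i))

record SkewShape : Set where
  field
    outer inner : List ℕ
    outerPartition : IsPartition outer
    innerPartition : IsPartition inner
    contained : ∀ i → part inner i ≤ part outer i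

diagram : SkewShape → Diagram
diagram s (i , j) = (1 ≤ i) × (part (SkewShape.inner s) i < j) × (j ≤ part (SkewShape.outer s) i)

NoEmptyRowsCols : SkewShape → Set
NoEmptyRowsCols s =
  (∀ i → 1 ≤ i → i ≤ length (SkewShape.outer s) → ∃ λ j → diagram s (i , j)) ×
  (∀ j → 1 ≤ j → j ≤ part (SkewShape.outer s) 1 → ∃ λ i → diagram s (i , j))

_≐_ : Diagram → Diagram → Set
D ≐ E = ∀ c → (D c → E c) × (E c → D c)

⟦_⟧ : List Cell → Diagram
⟦ P ⟧ c = c ∈ P

-- Deleting empty rows and columns of a finite set S of boxes:
-- the occupied rows (resp. columns) are relabelled order-preservingly 1,2,3,…
-- A row index a becomes its rank #{occupied rows r ≤ a}.
rank : List ℕ → ℕ → ℕ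
rank R a = length (filter (λ r → r ≤? a) R)

occRows occCols : List Cell → List ℕ
occRows S = deduplicate _≟_ (map proj₁ S)
occCols S = deduplicate _≟_ (map proj₂ S)

compress : List Cell → List Cell
compress S = map (λ c → rank (occRows S) (proj₁ c) , rank (occCols S) (proj₂ c)) S

_⊑_ : Diagram → Diagram → Set
D₁ ⊑ D₂ = Σ (List Cell) λ S → All D₂ S × (D₁ ≐ ⟦ compress S ⟧)

-- [a .. b] (empty if b < a)
range : ℕ → ℕ → List ℕ
range a b = map (a +_) (upTo (suc b ∸ a))

patA patB patC patD patE patF patG : List Cell
patA = (1 , 2) ∷ (1 , 3) ∷ (2 , 1) ∷ (2 , 2) ∷ []
patB = (1 , 2) ∷ (2 , 1) ∷ (2 , 2) ∷ (3 , 1) ∷ []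
patC = (1 , 3) ∷ (2 , 1) ∷ (2 , 2) ∷ (3 , 1) ∷ []
patD = (1 , 2) ∷ (1 , 3) ∷ (2 , 2) ∷ (3 , 1) ∷ []
patE = (1 , 3) ∷ (2 , 2) ∷ (3 , 1) ∷ (3 , 2) ∷ []
patF = (1 , 3) ∷ (2 , 2) ∷ (2 , 3) ∷ (3 , 1) ∷ []
patG = (1 , 2) ∷ (2 , 2) ∷ (3 , 1) ∷ (4 , 1) ∷ []

patH : ℕ → List Cell
patH r = (1 , 3) ∷ (2 , 2) ∷ map (λ i → (i , 1)) (range 3 r)

patI : ℕ → List Cell
patI r = (1 , 3) ∷ (r , 1) ∷ map (λ i → (i , 2)) (range 2 (r ∸ 1))

patJ : ℕ → List Cell
patJ r = (r ∸ 1 , 2) ∷ (r , 1) ∷ map (λ i → (i , 3)) (range 1 (r ∸ 2))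

DisjointRows : Diagram → Set
DisjointRows D = ∀ i i' j → D (i , j) → D (i' , j) → i ≡ i'

box2x2 : Diagram
box2x2 (i , j) = (1 ≤ i) × (i ≤ 2) × (1 ≤ j) × (j ≤ 2)

hook : ℕ → ℕ → Diagram
hook h l (i , j) = ((i ≡ 1) × (2 ≤ j) × (j ≤ h)) ⊎ ((j ≡ 1) × (2 ≤ i) × (i ≤ l))

hookFull : ℕ → ℕ → Diagram
hookFull h l (i , j) = hook h l (i , j) ⊎ ((i ≡ 1) × (j ≡ 1))

revHook : ℕ → ℕ → Diagram
revHook c l (i , j) = ((j ≡ c) × (1 ≤ i) × (i + 1 ≤ l)) ⊎ ((i ≡ l) × (1 ≤ j) × (j + 1 ≤ c))

revHookFull : ℕ → ℕ → Diagram
revHookFull c l (i , j) = revHook c l (i , j) ⊎ ((i ≡ l) × (j ≡ c))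

module Submission where

-- Either no column of D contains two boxes, and D is a disjoint union of rows, or
-- some column contains a domino: boxes (i,j) and (i+1,j) (by convexity of skew diagrams, two
-- boxes in one column give such a pair). Let L be the number of rows and N the length of the
-- first row; having no empty rows or columns, D contains the corners (1,N) and (L,1). Against
-- these corners a domino strictly inside gives (a), (d), (e) or (i), so j = 1 or j = N.
-- A domino in column 1 makes D a hook or the 2×2 box (the other cases give (a), (b), (c), (g),
-- (h)); a domino in column N ≥ 2 makes D a reverse hook or the 2×2 box ((a), (b), (f), (g), (j)).

open import Defs
open import Data.Nat using (ℕ; zero; suc; _+_; _≤_; _<_; _≤?_; _<?_; _≟_; z≤n; s≤s)
open import Data.Nat.Properties
open import Data.Product using (_×_; _,_; proj₁; proj₂; Σ; ∃)
open import Data.Sum using (_⊎_; inj₁; inj₂)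
open import Data.List using (List; []; _∷_; map; length; filter; deduplicate)
open import Data.List.Properties using (length-map; map-∘; map-cong)
open import Data.List.Relation.Unary.All using (All; []; _∷_)
import Data.List.Relation.Unary.All.Properties as All
open import Data.List.Relation.Unary.Linked using (Linked; [-]; _∷_)
open import Data.List.Membership.Propositional using (_∈_)
open import Data.Empty using (⊥; ⊥-elim)
open import Function using (_∘_)
open import Relation.Binary.Core using (_Preserves_⟶_)
open import Relation.Binary.Definitions using (tri<; tri≈; tri>)
open import Relation.Binary.PropositionalEquality
open import Relation.Nullary using (¬_; ¬?; Dec; yes; no)
open import Relation.Nullary.Negation using (contradiction)
open import Relation.Unary using (Decidable)

StrictlyIncreasing : (ℕ → ℕ) → Set
StrictlyIncreasing f = f Preserves _<_ ⟶ _<_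

filter-map : ∀ {A B : Set} {P : B → Set} {Q : A → Set} (P? : Decidable P) (Q? : Decidable Q)
  (f : A → B) → (∀ x → P (f x) → Q x) → (∀ x → Q x → P (f x)) →
  ∀ xs → filter P? (map f xs) ≡ map f (filter Q? xs)
filter-map P? Q? f P⇒Q Q⇒P [] = refl
filter-map P? Q? f P⇒Q Q⇒P (x ∷ xs) with P? (f x) | Q? x
... | yes _   | yes _  = cong (f x ∷_) (filter-map P? Q? f P⇒Q Q⇒P xs)
... | no _    | no _   = filter-map P? Q? f P⇒Q Q⇒P xs
... | yes Pfx | no ¬Qx = contradiction (P⇒Q x Pfx) ¬Qx
... | no ¬Pfx | yes Qx = contradiction (Q⇒P x Qx) ¬Pfx

module Increasing {f : ℕ → ℕ} (inc : StrictlyIncreasing f) where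

  reflects-≤ : ∀ {x y} → f x ≤ f y → x ≤ y
  reflects-≤ fx≤fy = ≮⇒≥ (λ y<x → <⇒≱ (inc y<x) fx≤fy)

  preserves-≤ : ∀ {x y} → x ≤ y → f x ≤ f y
  preserves-≤ x≤y with m≤n⇒m<n∨m≡n x≤y
  ... | inj₁ x<y  = <⇒≤ (inc x<y)
  ... | inj₂ refl = ≤-refl

  injective : ∀ {x y} → f x ≡ f y → x ≡ y
  injective e = ≤-antisym (reflects-≤ (≤-reflexive e)) (reflects-≤ (≤-reflexive (sym e)))

  deduplicate-map : ∀ xs → deduplicate _≟_ (map f xs) ≡ map f (deduplicate _≟_ xs)
  deduplicate-map [] = refl
  deduplicate-map (x ∷ xs) = cong (f x ∷_) (begin
      filter (¬? ∘ _≟_ (f x)) (deduplicate _≟_ (map f xs))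
    ≡⟨ cong (filter (¬? ∘ _≟_ (f x))) (deduplicate-map xs) ⟩
      filter (¬? ∘ _≟_ (f x)) (map f (deduplicate _≟_ xs))
    ≡⟨ filter-map (¬? ∘ _≟_ (f x)) (¬? ∘ _≟_ x) f
         (λ _ fx≢fy x≡y → fx≢fy (cong f x≡y)) (λ _ x≢y fx≡fy → x≢y (injective fx≡fy)) (deduplicate _≟_ xs) ⟩
      map f (filter (¬? ∘ _≟_ x) (deduplicate _≟_ xs)) ∎)
    where open ≡-Reasoning

  rank-map : ∀ R a → rank (deduplicate _≟_ (map f R)) (f a) ≡ rank (deduplicate _≟_ R) a
  rank-map R a = begin
      length (filter (_≤? f a) (deduplicate _≟_ (map f R)))
    ≡⟨ cong (length ∘ filter (_≤? f a)) (deduplicate-map R) ⟩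
      length (filter (_≤? f a) (map f (deduplicate _≟_ R)))
    ≡⟨ cong length (filter-map (_≤? f a) (_≤? a) f (λ _ → reflects-≤) (λ _ → preserves-≤) (deduplicate _≟_ R)) ⟩
      length (map f (filter (_≤? a) (deduplicate _≟_ R)))
    ≡⟨ length-map f (filter (_≤? a) (deduplicate _≟_ R)) ⟩
      length (filter (_≤? a) (deduplicate _≟_ R)) ∎
    where open ≡-Reasoning

relabel : (ℕ → ℕ) → (ℕ → ℕ) → Cell → Cell
relabel f g (a , b) = f a , g b

compress-relabel : ∀ {f g} → StrictlyIncreasing f → StrictlyIncreasing g →
  ∀ P → compress (map (relabel f g) P) ≡ compress P
compress-relabel {f} {g} incf incg P = begin
    map newLabel (map (relabel f g) P)
  ≡⟨ sym (map-∘ P) ⟩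
    map (newLabel ∘ relabel f g) P
  ≡⟨ map-cong (λ (a , b) → cong₂ _,_ (rows a) (cols b)) P ⟩
    compress P ∎
  where
    open ≡-Reasoning
    S = map (relabel f g) P
    newLabel : Cell → Cell
    newLabel (a , b) = rank (occRows S) a , rank (occCols S) b
    rows-of-S : map proj₁ S ≡ map f (map proj₁ P)
    rows-of-S = trans (sym (map-∘ P)) (map-∘ P)
    cols-of-S : map proj₂ S ≡ map g (map proj₂ P)
    cols-of-S = trans (sym (map-∘ P)) (map-∘ P)
    rows : ∀ a → rank (occRows S) (f a) ≡ rank (occRows P) a
    rows a = trans (cong (λ R → rank (deduplicate _≟_ R) (f a)) rows-of-S) (Increasing.rank-map incf (map proj₁ P) a)
    cols : ∀ b → rank (occCols S) (g b) ≡ rank (occCols P) b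
    cols b = trans (cong (λ C → rank (deduplicate _≟_ C) (g b)) cols-of-S) (Increasing.rank-map incg (map proj₂ P) b)

-- The map 0 ↦ p, k ↦ xs_k (1 ≤ k ≤ |xs|), continued by unit steps after the list;
-- it sends the rows (columns) 1, 2, 3, ... of a pattern to prescribed rows (columns) of D.
through : ℕ → List ℕ → ℕ → ℕ
through p xs       zero    = p
through p []       (suc k) = suc (through p [] k)
through p (x ∷ xs) (suc k) = through x xs k

through-step : ∀ {p xs} → Linked _<_ (p ∷ xs) → ∀ k → through p xs k < through p xs (suc k)
through-step {xs = []}     _           k       = n<1+n _
through-step {xs = x ∷ xs} (p<x ∷ _)   zero    = p<x
through-step {xs = x ∷ xs} (_ ∷ chain) (suc k) = through-step chain k

steps⇒increasing : ∀ {f} → (∀ k → f k < f (suc k)) → StrictlyIncreasing f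
steps⇒increasing step {x} {zero} ()
steps⇒increasing step {x} {suc y} (s≤s x≤y) with m≤n⇒m<n∨m≡n x≤y
... | inj₁ x<y  = <-trans (steps⇒increasing step x<y) (step y)
... | inj₂ refl = step x

placed : ∀ {D : Diagram} P rows cols → compress P ≡ P →
  Linked _<_ (0 ∷ rows) → Linked _<_ (0 ∷ cols) →
  All (D ∘ relabel (through 0 rows) (through 0 cols)) P → ⟦ P ⟧ ⊑ D
placed P rows cols normal rows↑ cols↑ inD =
  S , All.map⁺ inD , λ c → subst (c ∈_) (sym same) , subst (c ∈_) same
  where
    S = map (relabel (through 0 rows) (through 0 cols)) P
    same : compress S ≡ P
    same = trans (compress-relabel (steps⇒increasing (through-step rows↑))
                                   (steps⇒increasing (through-step cols↑)) P) normal

part-antitone : ∀ {l} → IsPartition l → ∀ {m n} → m ≤ n → part l (suc n) ≤ part l (suc m)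
part-antitone pl {m} {zero}  z≤n = ≤-refl
part-antitone pl {m} {suc n} m≤1+n with m≤n⇒m<n∨m≡n m≤1+n
... | inj₁ (s≤s m≤n) = ≤-trans (proj₂ pl n) (part-antitone pl m≤n)
... | inj₂ refl      = ≤-refl

part-beyond : ∀ l k → length l ≤ k → part l (suc k) ≡ 0
part-beyond []      k       _          = refl
part-beyond (x ∷ l) (suc k) (s≤s l≤k) = part-beyond l k l≤k

≤-split : ∀ {m n} → m ≤ n → m < n ⊎ n ≡ m
≤-split m≤n with m≤n⇒m<n∨m≡n m≤n
... | inj₁ m<n = inj₁ m<n
... | inj₂ m≡n = inj₂ (sym m≡n)

+1≤⇒< : ∀ {x n} → x + 1 ≤ n → x < n
+1≤⇒< {x} {n} = subst (_≤ n) (+-comm x 1)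

<⇒+1≤ : ∀ {x n} → x < n → x + 1 ≤ n
<⇒+1≤ {x} {n} = subst (_≤ n) (+-comm 1 x)

predecessor : ∀ {n} → 1 ≤ n → ∃ λ m → n ≡ suc m
predecessor {suc m} _ = m , refl

module Geometry (s : SkewShape) where

  open SkewShape s

  lam mu : ℕ → ℕ
  lam = part outer
  mu  = part inner

  L N : ℕ
  L = length outer
  N = lam 1

  Box : ℕ → ℕ → Set
  Box x y = diagram s (x , y)

  row≥1 : ∀ {x y} → Box x y → 1 ≤ x
  row≥1 = proj₁

  mu< : ∀ {x y} → Box x y → mu x < y
  mu< b = proj₁ (proj₂ b)

  ≤lam : ∀ {x y} → Box x y → y ≤ lam x
  ≤lam b = proj₂ (proj₂ b)

  col≥1 : ∀ {x y} → Box x y → 1 ≤ y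
  col≥1 b = ≤-trans (s≤s z≤n) (mu< b)

  lam-antitone : ∀ {a b} → 1 ≤ a → a ≤ b → lam b ≤ lam a
  lam-antitone {suc a} {suc b} _ (s≤s a≤b) = part-antitone outerPartition a≤b

  mu-antitone : ∀ {a b} → 1 ≤ a → a ≤ b → mu b ≤ mu a
  mu-antitone {suc a} {suc b} _ (s≤s a≤b) = part-antitone innerPartition a≤b

  lam≤N : ∀ {x} → 1 ≤ x → lam x ≤ N
  lam≤N = lam-antitone ≤-refl

  lam-beyond : ∀ {x} → L < x → lam x ≡ 0
  lam-beyond {suc k} (s≤s L≤k) = part-beyond outer k L≤k

  row≤L : ∀ {x y} → Box x y → x ≤ L
  row≤L {x} b = ≮⇒≥ (λ L<x → <⇒≱ (≤-trans (col≥1 b) (≤lam b)) (≤-reflexive (lam-beyond L<x)))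

  N≥1⇒L≥1 : 1 ≤ N → 1 ≤ L
  N≥1⇒L≥1 N≥1 = ≮⇒≥ (λ L<1 → <⇒≱ N≥1 (≤-reflexive (lam-beyond L<1)))

  convex : ∀ {a b c d x y} → Box a b → Box c d → a ≤ x → x ≤ c → b ≤ y → y ≤ d → Box x y
  convex ba bc a≤x x≤c b≤y y≤d =
    ≤-trans (row≥1 ba) a≤x ,
    ≤-<-trans (mu-antitone (row≥1 ba) a≤x) (<-≤-trans (mu< ba) b≤y) ,
    ≤-trans y≤d (≤-trans (≤lam bc) (lam-antitone (≤-trans (row≥1 ba) a≤x) x≤c))

  -- two boxes on top of each other; their existence is what separates the special
  -- shapes from disjoint unions of rows
  Domino : ℕ → ℕ → Set
  Domino i j = Box i j × Box (suc i) j

  is-box2x2 : L ≡ 2 → mu 1 ≡ 0 → mu 2 ≡ 0 → lam 1 ≡ 2 → lam 2 ≡ 2 → diagram s ≐ box2x2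
  is-box2x2 L≡2 μ₁ μ₂ λ₁ λ₂ (x , y) = fwd x , bwd x
    where
      fwd : ∀ x → Box x y → box2x2 (x , y)
      fwd 1 (_ , p , q) = s≤s z≤n , s≤s z≤n , subst (_< y) μ₁ p , subst (y ≤_) λ₁ q
      fwd 2 (_ , p , q) = s≤s z≤n , ≤-refl , subst (_< y) μ₂ p , subst (y ≤_) λ₂ q
      fwd (suc (suc (suc x))) b = ⊥-elim (<⇒≱ (s≤s (s≤s (s≤s z≤n))) (subst (_ ≤_) L≡2 (row≤L b)))
      bwd : ∀ x → box2x2 (x , y) → Box x y
      bwd 1 (_ , _ , p , q) = s≤s z≤n , subst (_< y) (sym μ₁) p , subst (y ≤_) (sym λ₁) q
      bwd 2 (_ , _ , p , q) = s≤s z≤n , subst (_< y) (sym μ₂) p , subst (y ≤_) (sym λ₂) q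
      bwd (suc (suc (suc x))) (_ , s≤s (s≤s ()) , _)

  module FirstColumn (mu-low : ∀ x → 2 ≤ x → mu x ≡ 0) (lam-low : ∀ x → 2 ≤ x → x ≤ L → lam x ≡ 1) where

    first-column : ∀ {x} → 2 ≤ x → x ≤ L → Box x 1
    first-column {x} 2≤x x≤L = ≤-trans (s≤s z≤n) 2≤x , subst (_< 1) (sym (mu-low x 2≤x)) (s≤s z≤n) ,
                               ≤-reflexive (sym (lam-low x 2≤x x≤L))

    in-first-column : ∀ {x y} → 2 ≤ x → Box x y → y ≡ 1
    in-first-column 2≤x b = ≤-antisym (subst (_ ≤_) (lam-low _ 2≤x (row≤L b)) (≤lam b)) (col≥1 b)

    is-hook : mu 1 ≡ 1 → diagram s ≐ hook N L
    is-hook μ₁ (x , y) = fwd x , bwd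
      where
        fwd : ∀ x → Box x y → hook N L (x , y)
        fwd 1 (_ , p , q) = inj₁ (refl , subst (_< y) μ₁ p , q)
        fwd (suc (suc x)) b = inj₂ (in-first-column (s≤s (s≤s z≤n)) b , s≤s (s≤s z≤n) , row≤L b)
        bwd : hook N L (x , y) → Box x y
        bwd (inj₁ (refl , p , q)) = s≤s z≤n , subst (_< y) (sym μ₁) p , q
        bwd (inj₂ (refl , p , q)) = first-column p q

    is-hookFull : 1 ≤ N → mu 1 ≡ 0 → diagram s ≐ hookFull N L
    is-hookFull N≥1 μ₁ (x , y) = fwd x , bwd
      where
        fwd : ∀ x → Box x y → hookFull N L (x , y)
        fwd 1 (_ , p , q) with y ≟ 1
        ... | yes y≡1 = inj₂ (refl , y≡1)
        ... | no y≢1  = inj₁ (inj₁ (refl , ≤∧≢⇒< (subst (_< y) μ₁ p) (λ e → y≢1 (sym e)) , q))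
        fwd (suc (suc x)) b = inj₁ (inj₂ (in-first-column (s≤s (s≤s z≤n)) b , s≤s (s≤s z≤n) , row≤L b))
        bwd : hookFull N L (x , y) → Box x y
        bwd (inj₁ (inj₁ (refl , p , q))) = s≤s z≤n , subst (_< y) (sym μ₁) (≤-trans (s≤s z≤n) p) , q
        bwd (inj₁ (inj₂ (refl , p , q))) = first-column p q
        bwd (inj₂ (refl , refl))         = s≤s z≤n , subst (_< 1) (sym μ₁) (s≤s z≤n) , N≥1

  module LastColumn (N' : ℕ) (N≡ : N ≡ suc N')
      (mu-high : ∀ x → 1 ≤ x → x < L → mu x ≡ N') (lam-high : ∀ x → 1 ≤ x → x < L → lam x ≡ N)
      (mu-L : mu L ≡ 0) where

    last-column : ∀ {x} → 1 ≤ x → x < L → Box x N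
    last-column {x} 1≤x x<L = 1≤x , subst₂ _<_ (sym (mu-high x 1≤x x<L)) (sym N≡) ≤-refl ,
                              ≤-reflexive (sym (lam-high x 1≤x x<L))

    in-last-column : ∀ {x y} → Box x y → x < L → y ≡ N
    in-last-column {x} {y} b x<L = ≤-antisym
      (subst (y ≤_) (lam-high x (row≥1 b) x<L) (≤lam b))
      (subst (_≤ y) (sym N≡) (subst (_< y) (mu-high x (row≥1 b) x<L) (mu< b)))

    in-last-row : ∀ {x y} → Box x y → ¬ x < L → x ≡ L
    in-last-row b x≮L = ≤-antisym (row≤L b) (≮⇒≥ x≮L)

    1≤N : 1 ≤ N
    1≤N = subst (1 ≤_) (sym N≡) (s≤s z≤n)

    1≤L : 1 ≤ L
    1≤L = N≥1⇒L≥1 1≤N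

    is-revHook : lam L ≡ N' → diagram s ≐ revHook N L
    is-revHook λL (x , y) = fwd , bwd
      where
        fwd : Box x y → revHook N L (x , y)
        fwd b with x <? L
        ... | yes x<L = inj₁ (in-last-column b x<L , row≥1 b , <⇒+1≤ x<L)
        ... | no x≮L with in-last-row b x≮L
        ... | refl = inj₂ (refl , col≥1 b , <⇒+1≤ (subst (y <_) (sym N≡) (s≤s (subst (y ≤_) λL (≤lam b)))))
        bwd : revHook N L (x , y) → Box x y
        bwd (inj₁ (refl , p , q)) = last-column p (+1≤⇒< q)
        bwd (inj₂ (refl , p , q)) = 1≤L , subst (_< y) (sym mu-L) p ,
                                    subst (y ≤_) (sym λL) (≤-pred (subst (y <_) N≡ (+1≤⇒< q)))

    is-revHookFull : lam L ≡ N → diagram s ≐ revHookFull N L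
    is-revHookFull λL (x , y) = fwd , bwd
      where
        fwd : Box x y → revHookFull N L (x , y)
        fwd b with x <? L
        ... | yes x<L = inj₁ (inj₁ (in-last-column b x<L , row≥1 b , <⇒+1≤ x<L))
        ... | no x≮L with in-last-row b x≮L | y ≟ N
        ... | refl | yes y≡N = inj₂ (refl , y≡N)
        ... | refl | no y≢N  = inj₁ (inj₂ (refl , col≥1 b , <⇒+1≤ (≤∧≢⇒< (subst (y ≤_) λL (≤lam b)) y≢N)))
        bwd : revHookFull N L (x , y) → Box x y
        bwd (inj₁ (inj₁ (refl , p , q))) = last-column p (+1≤⇒< q)
        bwd (inj₁ (inj₂ (refl , p , q))) = 1≤L , subst (_< y) (sym mu-L) p ,
                                           subst (y ≤_) (sym λL) (<⇒≤ (+1≤⇒< q))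
        bwd (inj₂ (refl , refl)) = 1≤L , subst (_< N) (sym mu-L) 1≤N , ≤-reflexive (sym λL)

module Framed (s : SkewShape) (ne : NoEmptyRowsCols s) where

  open Geometry s

  row-nonempty : ∀ {x} → 1 ≤ x → x ≤ L → mu x < lam x
  row-nonempty 1≤x x≤L with proj₁ ne _ 1≤x x≤L
  ... | _ , b = <-≤-trans (mu< b) (≤lam b)

  column-nonempty : ∀ {y} → 1 ≤ y → y ≤ N → ∃ λ x → Box x y
  column-nonempty = proj₂ ne _

  module Corners (L≥1 : 1 ≤ L) where

    top-right : Box 1 N
    top-right = s≤s z≤n , row-nonempty (s≤s z≤n) L≥1 , ≤-refl

    N≥1 : 1 ≤ N
    N≥1 = col≥1 top-right

    bottom-left : Box L 1
    bottom-left with column-nonempty (s≤s z≤n) N≥1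
    ... | _ , b = L≥1 , ≤-<-trans (mu-antitone (row≥1 b) (row≤L b)) (mu< b) ,
                  ≤-trans (s≤s z≤n) (row-nonempty L≥1 ≤-refl)

    mu-L≡0 : mu L ≡ 0
    mu-L≡0 = n<1⇒n≡0 (mu< bottom-left)

-- Each forbidden pattern, read as a configuration of boxes of D in increasing rows and
-- columns. The hypotheses on (h), (i), (j) are only used for r = 4.
module Avoiding (s : SkewShape)
    (nA : ¬ (⟦ patA ⟧ ⊑ diagram s)) (nB : ¬ (⟦ patB ⟧ ⊑ diagram s)) (nC : ¬ (⟦ patC ⟧ ⊑ diagram s))
    (nD : ¬ (⟦ patD ⟧ ⊑ diagram s)) (nE : ¬ (⟦ patE ⟧ ⊑ diagram s)) (nF : ¬ (⟦ patF ⟧ ⊑ diagram s))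
    (nG : ¬ (⟦ patG ⟧ ⊑ diagram s)) (nH : ¬ (⟦ patH 4 ⟧ ⊑ diagram s))
    (nI : ¬ (⟦ patI 4 ⟧ ⊑ diagram s)) (nJ : ¬ (⟦ patJ 4 ⟧ ⊑ diagram s)) where

  open Geometry s

  no-A : ∀ {r₁ r₂ c₁ c₂ c₃} → r₁ < r₂ → c₁ < c₂ → c₂ < c₃ →
         Box r₁ c₂ → Box r₁ c₃ → Box r₂ c₁ → Box r₂ c₂ → ⊥
  no-A {r₁} {r₂} {c₁} {c₂} {c₃} r₁₂ c₁₂ c₂₃ b₁ b₂ b₃ b₄ =
    nA (placed patA (r₁ ∷ r₂ ∷ []) (c₁ ∷ c₂ ∷ c₃ ∷ []) refl
         (row≥1 b₁ ∷ r₁₂ ∷ [-]) (col≥1 b₃ ∷ c₁₂ ∷ c₂₃ ∷ [-]) (b₁ ∷ b₂ ∷ b₃ ∷ b₄ ∷ []))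

  no-B : ∀ {r₁ r₂ r₃ c₁ c₂} → r₁ < r₂ → r₂ < r₃ → c₁ < c₂ →
         Box r₁ c₂ → Box r₂ c₁ → Box r₂ c₂ → Box r₃ c₁ → ⊥
  no-B {r₁} {r₂} {r₃} {c₁} {c₂} r₁₂ r₂₃ c₁₂ b₁ b₂ b₃ b₄ =
    nB (placed patB (r₁ ∷ r₂ ∷ r₃ ∷ []) (c₁ ∷ c₂ ∷ []) refl
         (row≥1 b₁ ∷ r₁₂ ∷ r₂₃ ∷ [-]) (col≥1 b₂ ∷ c₁₂ ∷ [-]) (b₁ ∷ b₂ ∷ b₃ ∷ b₄ ∷ []))

  no-C : ∀ {r₁ r₂ r₃ c₁ c₂ c₃} → r₁ < r₂ → r₂ < r₃ → c₁ < c₂ → c₂ < c₃ →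
         Box r₁ c₃ → Box r₂ c₁ → Box r₂ c₂ → Box r₃ c₁ → ⊥
  no-C {r₁} {r₂} {r₃} {c₁} {c₂} {c₃} r₁₂ r₂₃ c₁₂ c₂₃ b₁ b₂ b₃ b₄ =
    nC (placed patC (r₁ ∷ r₂ ∷ r₃ ∷ []) (c₁ ∷ c₂ ∷ c₃ ∷ []) refl
         (row≥1 b₁ ∷ r₁₂ ∷ r₂₃ ∷ [-]) (col≥1 b₂ ∷ c₁₂ ∷ c₂₃ ∷ [-]) (b₁ ∷ b₂ ∷ b₃ ∷ b₄ ∷ []))

  no-D : ∀ {r₁ r₂ r₃ c₁ c₂ c₃} → r₁ < r₂ → r₂ < r₃ → c₁ < c₂ → c₂ < c₃ →
         Box r₁ c₂ → Box r₁ c₃ → Box r₂ c₂ → Box r₃ c₁ → ⊥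
  no-D {r₁} {r₂} {r₃} {c₁} {c₂} {c₃} r₁₂ r₂₃ c₁₂ c₂₃ b₁ b₂ b₃ b₄ =
    nD (placed patD (r₁ ∷ r₂ ∷ r₃ ∷ []) (c₁ ∷ c₂ ∷ c₃ ∷ []) refl
         (row≥1 b₁ ∷ r₁₂ ∷ r₂₃ ∷ [-]) (col≥1 b₄ ∷ c₁₂ ∷ c₂₃ ∷ [-]) (b₁ ∷ b₂ ∷ b₃ ∷ b₄ ∷ []))

  no-E : ∀ {r₁ r₂ r₃ c₁ c₂ c₃} → r₁ < r₂ → r₂ < r₃ → c₁ < c₂ → c₂ < c₃ →
         Box r₁ c₃ → Box r₂ c₂ → Box r₃ c₁ → Box r₃ c₂ → ⊥
  no-E {r₁} {r₂} {r₃} {c₁} {c₂} {c₃} r₁₂ r₂₃ c₁₂ c₂₃ b₁ b₂ b₃ b₄ =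
    nE (placed patE (r₁ ∷ r₂ ∷ r₃ ∷ []) (c₁ ∷ c₂ ∷ c₃ ∷ []) refl
         (row≥1 b₁ ∷ r₁₂ ∷ r₂₃ ∷ [-]) (col≥1 b₃ ∷ c₁₂ ∷ c₂₃ ∷ [-]) (b₁ ∷ b₂ ∷ b₃ ∷ b₄ ∷ []))

  no-F : ∀ {r₁ r₂ r₃ c₁ c₂ c₃} → r₁ < r₂ → r₂ < r₃ → c₁ < c₂ → c₂ < c₃ →
         Box r₁ c₃ → Box r₂ c₂ → Box r₂ c₃ → Box r₃ c₁ → ⊥
  no-F {r₁} {r₂} {r₃} {c₁} {c₂} {c₃} r₁₂ r₂₃ c₁₂ c₂₃ b₁ b₂ b₃ b₄ =
    nF (placed patF (r₁ ∷ r₂ ∷ r₃ ∷ []) (c₁ ∷ c₂ ∷ c₃ ∷ []) refl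
         (row≥1 b₁ ∷ r₁₂ ∷ r₂₃ ∷ [-]) (col≥1 b₄ ∷ c₁₂ ∷ c₂₃ ∷ [-]) (b₁ ∷ b₂ ∷ b₃ ∷ b₄ ∷ []))

  no-G : ∀ {r₁ r₂ r₃ r₄ c₁ c₂} → r₁ < r₂ → r₂ < r₃ → r₃ < r₄ → c₁ < c₂ →
         Box r₁ c₂ → Box r₂ c₂ → Box r₃ c₁ → Box r₄ c₁ → ⊥
  no-G {r₁} {r₂} {r₃} {r₄} {c₁} {c₂} r₁₂ r₂₃ r₃₄ c₁₂ b₁ b₂ b₃ b₄ =
    nG (placed patG (r₁ ∷ r₂ ∷ r₃ ∷ r₄ ∷ []) (c₁ ∷ c₂ ∷ []) refl
         (row≥1 b₁ ∷ r₁₂ ∷ r₂₃ ∷ r₃₄ ∷ [-]) (col≥1 b₃ ∷ c₁₂ ∷ [-]) (b₁ ∷ b₂ ∷ b₃ ∷ b₄ ∷ []))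

  no-H : ∀ {r₁ r₂ r₃ r₄ c₁ c₂ c₃} → r₁ < r₂ → r₂ < r₃ → r₃ < r₄ → c₁ < c₂ → c₂ < c₃ →
         Box r₁ c₃ → Box r₂ c₂ → Box r₃ c₁ → Box r₄ c₁ → ⊥
  no-H {r₁} {r₂} {r₃} {r₄} {c₁} {c₂} {c₃} r₁₂ r₂₃ r₃₄ c₁₂ c₂₃ b₁ b₂ b₃ b₄ =
    nH (placed (patH 4) (r₁ ∷ r₂ ∷ r₃ ∷ r₄ ∷ []) (c₁ ∷ c₂ ∷ c₃ ∷ []) refl
         (row≥1 b₁ ∷ r₁₂ ∷ r₂₃ ∷ r₃₄ ∷ [-]) (col≥1 b₃ ∷ c₁₂ ∷ c₂₃ ∷ [-]) (b₁ ∷ b₂ ∷ b₃ ∷ b₄ ∷ []))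

  no-I : ∀ {r₁ r₂ r₃ r₄ c₁ c₂ c₃} → r₁ < r₂ → r₂ < r₃ → r₃ < r₄ → c₁ < c₂ → c₂ < c₃ →
         Box r₁ c₃ → Box r₂ c₂ → Box r₃ c₂ → Box r₄ c₁ → ⊥
  no-I {r₁} {r₂} {r₃} {r₄} {c₁} {c₂} {c₃} r₁₂ r₂₃ r₃₄ c₁₂ c₂₃ b₁ b₂ b₃ b₄ =
    nI (placed (patI 4) (r₁ ∷ r₂ ∷ r₃ ∷ r₄ ∷ []) (c₁ ∷ c₂ ∷ c₃ ∷ []) refl
         (row≥1 b₁ ∷ r₁₂ ∷ r₂₃ ∷ r₃₄ ∷ [-]) (col≥1 b₄ ∷ c₁₂ ∷ c₂₃ ∷ [-]) (b₁ ∷ b₄ ∷ b₂ ∷ b₃ ∷ []))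

  no-J : ∀ {r₁ r₂ r₃ r₄ c₁ c₂ c₃} → r₁ < r₂ → r₂ < r₃ → r₃ < r₄ → c₁ < c₂ → c₂ < c₃ →
         Box r₁ c₃ → Box r₂ c₃ → Box r₃ c₂ → Box r₄ c₁ → ⊥
  no-J {r₁} {r₂} {r₃} {r₄} {c₁} {c₂} {c₃} r₁₂ r₂₃ r₃₄ c₁₂ c₂₃ b₁ b₂ b₃ b₄ =
    nJ (placed (patJ 4) (r₁ ∷ r₂ ∷ r₃ ∷ r₄ ∷ []) (c₁ ∷ c₂ ∷ c₃ ∷ []) refl
         (row≥1 b₁ ∷ r₁₂ ∷ r₂₃ ∷ r₃₄ ∷ [-]) (col≥1 b₄ ∷ c₁₂ ∷ c₂₃ ∷ [-]) (b₃ ∷ b₄ ∷ b₁ ∷ b₂ ∷ []))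

SpecialShape : Diagram → Set
SpecialShape D = (D ≐ box2x2)
  ⊎ (Σ ℕ λ h → Σ ℕ λ l → (1 ≤ h) × (1 ≤ l) × ((D ≐ hook h l) ⊎ (D ≐ hookFull h l)))
  ⊎ (Σ ℕ λ c → Σ ℕ λ l → (1 ≤ c) × (1 ≤ l) × ((D ≐ revHook c l) ⊎ (D ≐ revHookFull c l)))

module Classification (s : SkewShape) (ne : NoEmptyRowsCols s)
    (nA : ¬ (⟦ patA ⟧ ⊑ diagram s)) (nB : ¬ (⟦ patB ⟧ ⊑ diagram s)) (nC : ¬ (⟦ patC ⟧ ⊑ diagram s))
    (nD : ¬ (⟦ patD ⟧ ⊑ diagram s)) (nE : ¬ (⟦ patE ⟧ ⊑ diagram s)) (nF : ¬ (⟦ patF ⟧ ⊑ diagram s))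
    (nG : ¬ (⟦ patG ⟧ ⊑ diagram s)) (nH : ¬ (⟦ patH 4 ⟧ ⊑ diagram s))
    (nI : ¬ (⟦ patI 4 ⟧ ⊑ diagram s)) (nJ : ¬ (⟦ patJ 4 ⟧ ⊑ diagram s)) where

  open Geometry s
  open Framed s ne
  open Avoiding s nA nB nC nD nE nF nG nH nI nJ

  module _ (L≥1 : 1 ≤ L) where

    open Corners L≥1

    -- A domino strictly between the first and the last column, together with the two
    -- corners, forms (a), (d), (e) or (i), depending on whether it touches the first or last row.
    interior-domino : ∀ {i j} → 1 < j → j < N → Domino i j → ⊥
    interior-domino {i} {j} 1<j j<N (bᵢ , bᵢ₊₁) with ≤-split (row≥1 bᵢ) | ≤-split (row≤L bᵢ₊₁)
    ... | inj₂ refl | inj₂ L≡2  = no-A (n<1+n 1) 1<j j<N bᵢ top-right (subst (λ x → Box x 1) L≡2 bottom-left) bᵢ₊₁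
    ... | inj₂ refl | inj₁ 2<L  = no-D (n<1+n 1) 2<L 1<j j<N bᵢ top-right bᵢ₊₁ bottom-left
    ... | inj₁ 1<i  | inj₂ L≡i+1 = no-E 1<i (subst (i <_) (sym L≡i+1) (n<1+n i)) 1<j j<N top-right bᵢ bottom-left
                                      (subst (λ x → Box x j) (sym L≡i+1) bᵢ₊₁)
    ... | inj₁ 1<i  | inj₁ i+1<L = no-I 1<i (n<1+n i) i+1<L 1<j j<N top-right bᵢ bᵢ₊₁ bottom-left

    domino-column : ∀ {i j} → Domino i j → j ≡ 1 ⊎ j ≡ N
    domino-column {i} {j} dom@(bᵢ , _) with ≤-split (col≥1 bᵢ) | ≤-split (≤-trans (≤lam bᵢ) (lam≤N (row≥1 bᵢ)))
    ... | inj₂ j≡1 | _         = inj₁ j≡1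
    ... | inj₁ _   | inj₂ N≡j  = inj₂ (sym N≡j)
    ... | inj₁ 1<j | inj₁ j<N  = ⊥-elim (interior-domino 1<j j<N dom)

    -- A domino in column 1 forces row 2 to start in column 1: otherwise the first box of
    -- row 2, the corner (1,N) and the domino form (h), or (g) when that box is (2,N).
    second-row-starts-at-1 : ∀ {i} → Domino i 1 → mu 2 ≡ 0
    second-row-starts-at-1 {i} (bᵢ , bᵢ₊₁) with mu 2 ≟ 0
    ... | yes μ₂≡0 = μ₂≡0
    ... | no μ₂≢0  = ⊥-elim (second-row-start (≤-split (≤-trans (≤lam b₂) (lam≤N (s≤s z≤n)))))
      where
        2<i : 2 < i
        2<i = ≰⇒> (λ i≤2 → μ₂≢0 (n<1⇒n≡0 (≤-<-trans (mu-antitone (row≥1 bᵢ) i≤2) (mu< bᵢ))))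
        b₂ : Box 2 (suc (mu 2))
        b₂ = s≤s z≤n , ≤-refl , row-nonempty (s≤s z≤n) (≤-trans (<⇒≤ 2<i) (≤-trans (n≤1+n i) (row≤L bᵢ₊₁)))
        1<y : 1 < suc (mu 2)
        1<y = s≤s (n≢0⇒n>0 μ₂≢0)
        second-row-start : suc (mu 2) < N ⊎ N ≡ suc (mu 2) → ⊥
        second-row-start (inj₁ y<N) = no-H (n<1+n 1) 2<i (n<1+n i) 1<y y<N top-right b₂ bᵢ bᵢ₊₁
        second-row-start (inj₂ N≡y) = no-G (n<1+n 1) 2<i (n<1+n i) (subst (1 <_) (sym N≡y) 1<y)
                                           top-right (subst (Box 2) (sym N≡y) b₂) bᵢ bᵢ₊₁

    -- If row 2 reaches column 2, a third row would give (b) or (c), and a third column (a):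
    -- D is the 2×2 box.
    wide-second-row : ∀ {i} → Domino i 1 → 2 ≤ lam 2 → diagram s ≐ box2x2
    wide-second-row {i} dom@(bᵢ , bᵢ₊₁) 2≤λ₂ =
      is-box2x2 L≡2 μ₁≡0 μ₂≡0 (≤-antisym N≤2 2≤N) (≤-antisym (≤-trans (lam≤N (s≤s z≤n)) N≤2) 2≤λ₂)
      where
        μ₂≡0 : mu 2 ≡ 0
        μ₂≡0 = second-row-starts-at-1 dom
        b₂₁ : Box 2 1
        b₂₁ = s≤s z≤n , subst (_< 1) (sym μ₂≡0) (s≤s z≤n) , ≤-trans (s≤s z≤n) 2≤λ₂
        b₂₂ : Box 2 2
        b₂₂ = s≤s z≤n , subst (_< 2) (sym μ₂≡0) (s≤s z≤n) , 2≤λ₂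
        2≤N : 2 ≤ N
        2≤N = ≤-trans 2≤λ₂ (lam≤N (s≤s z≤n))
        no-third-row : ¬ Box 3 1
        no-third-row b₃₁ with mu 1 ≤? 1
        ... | yes μ₁≤1 = no-B (n<1+n 1) (n<1+n 2) (n<1+n 1) (s≤s z≤n , s≤s μ₁≤1 , 2≤N) b₂₁ b₂₂ b₃₁
        ... | no μ₁≰1  = no-C (n<1+n 1) (n<1+n 2) (n<1+n 1) (≤-<-trans (≰⇒> μ₁≰1) (mu< top-right))
                              top-right b₂₁ b₂₂ b₃₁
        L≡2 : L ≡ 2
        L≡2 with ≤-split (≤-trans (s≤s (row≥1 bᵢ)) (row≤L bᵢ₊₁))
        ... | inj₁ 2<L = ⊥-elim (no-third-row (convex b₂₁ bottom-left (n≤1+n 2) 2<L ≤-refl ≤-refl))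
        ... | inj₂ L≡2 = L≡2
        μ₁≡0 : mu 1 ≡ 0
        μ₁≡0 = n<1⇒n≡0 (subst (λ x → mu x < 1) i≡1 (mu< bᵢ))
          where i≡1 = ≤-antisym (≤-pred (subst (suc i ≤_) L≡2 (row≤L bᵢ₊₁))) (row≥1 bᵢ)
        N≤2 : N ≤ 2
        N≤2 = ≮⇒≥ (λ 2<N → no-A (n<1+n 1) (n<1+n 1) 2<N
                     (s≤s z≤n , subst (_< 2) (sym μ₁≡0) (s≤s z≤n) , 2≤N) top-right b₂₁ b₂₂)

    -- If row 2 ends in column 1, then all rows below the first are the single box (x,1),
    mu-low : ∀ {i} → Domino i 1 → ∀ x → 2 ≤ x → mu x ≡ 0
    mu-low dom x 2≤x = n≤0⇒n≡0 (subst (mu x ≤_) (second-row-starts-at-1 dom) (mu-antitone (s≤s z≤n) 2≤x))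

    lam-low : lam 2 ≤ 1 → ∀ x → 2 ≤ x → x ≤ L → lam x ≡ 1
    lam-low λ₂≤1 x 2≤x x≤L = ≤-antisym (≤-trans (lam-antitone (s≤s z≤n) 2≤x) λ₂≤1)
                                       (≤-trans (s≤s z≤n) (row-nonempty (≤-trans (s≤s z≤n) 2≤x) x≤L))

    -- and the first row starts in column 1 or 2, since column 2 must be occupied.
    first-row-start≤1 : lam 2 ≤ 1 → mu 1 ≤ 1
    first-row-start≤1 λ₂≤1 = ≮⇒≥ λ 1<μ₁ → column-two-empty 1<μ₁ (column-nonempty (s≤s z≤n) (≤-trans 1<μ₁ (<⇒≤ (mu< top-right))))
      where
        column-two-empty : 1 < mu 1 → ¬ ∃ λ x → Box x 2
        column-two-empty 1<μ₁ (x , b) with ≤-split (row≥1 b)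
        ... | inj₂ refl = <⇒≱ 1<μ₁ (≤-pred (mu< b))
        ... | inj₁ 1<x  = <⇒≱ (s≤s z≤n) (≤-pred (≤-trans (≤lam b) (≤-trans (lam-antitone (s≤s z≤n) 1<x) λ₂≤1)))

    first-column-domino : ∀ {i} → Domino i 1 → SpecialShape (diagram s)
    first-column-domino dom with lam 2 ≤? 1
    ... | no λ₂≰1  = inj₁ (wide-second-row dom (≰⇒> λ₂≰1))
    ... | yes λ₂≤1 = inj₂ (inj₁ (N , L , N≥1 , L≥1 , hooks (mu 1 ≟ 0)))
      where
        open FirstColumn (mu-low dom) (lam-low λ₂≤1)
        hooks : Dec (mu 1 ≡ 0) → (diagram s ≐ hook N L) ⊎ (diagram s ≐ hookFull N L)
        hooks (yes μ₁≡0) = inj₂ (is-hookFull N≥1 μ₁≡0)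
        hooks (no μ₁≢0)  = inj₁ (is-hook (≤-antisym (first-row-start≤1 λ₂≤1) (n≢0⇒n>0 μ₁≢0)))

    -- A domino in the last column N forces row L-1 to reach column N: otherwise row L-1 ends
    -- before N, and with the domino and (L,1) we get (j), or (g) if it ends in column 1.
    penultimate-row-full : ∀ {i M} → L ≡ suc M → Domino i N → lam M ≡ N
    penultimate-row-full {i} {M} L≡ (bᵢ , bᵢ₊₁) = ≤-antisym (lam≤N 1≤M) (≮⇒≥ short-penultimate)
      where
        1≤M : 1 ≤ M
        1≤M = ≤-trans (row≥1 bᵢ) (≤-pred (subst (suc i ≤_) L≡ (row≤L bᵢ₊₁)))
        M<L : M < L
        M<L = subst (M <_) (sym L≡) (n<1+n M)
        short-penultimate : ¬ lam M < N
        short-penultimate λM<N = row-M-shape (≤-split (≤-trans (s≤s z≤n) (row-nonempty 1≤M (<⇒≤ M<L))))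
          where
            i+1<M : suc i < M
            i+1<M = ≰⇒> (λ M≤i+1 → <⇒≱ λM<N (≤-trans (≤lam bᵢ₊₁) (lam-antitone 1≤M M≤i+1)))
            bM : Box M (lam M)
            bM = 1≤M , row-nonempty 1≤M (<⇒≤ M<L) , ≤-refl
            row-M-shape : 1 < lam M ⊎ lam M ≡ 1 → ⊥
            row-M-shape (inj₁ 1<λM) = no-J (n<1+n i) i+1<M M<L 1<λM λM<N bᵢ bᵢ₊₁ bM bottom-left
            row-M-shape (inj₂ λM≡1) = no-G (n<1+n i) i+1<M M<L (subst (_< N) λM≡1 λM<N)
                                           bᵢ bᵢ₊₁ (subst (Box M) λM≡1 bM) bottom-left

    lam-high : ∀ {i M} → L ≡ suc M → Domino i N → ∀ x → 1 ≤ x → x < L → lam x ≡ N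
    lam-high L≡ dom x 1≤x x<L = ≤-antisym (lam≤N 1≤x)
      (subst (_≤ lam x) (penultimate-row-full L≡ dom) (lam-antitone 1≤x (≤-pred (subst (x <_) L≡ x<L))))

    -- If row L-1 contains column N-1, then with the corner (1,N) and the last row we get (b) or (f)
    -- unless L = 2, and then (a) unless N = 2: D is the 2×2 box.
    early-penultimate-start : ∀ {i N' M} → N ≡ suc N' → 1 ≤ N' → L ≡ suc M → Domino i N → mu M < N' →
      diagram s ≐ box2x2
    early-penultimate-start {i} {N'} {M} N≡ 1≤N' L≡ dom@(bᵢ , bᵢ₊₁) μM<N' = two-rows (≤-split 1≤M)
      where
        i≤M : i ≤ M
        i≤M = ≤-pred (subst (suc i ≤_) L≡ (row≤L bᵢ₊₁))
        1≤M : 1 ≤ M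
        1≤M = ≤-trans (row≥1 bᵢ) i≤M
        M<L : M < L
        M<L = subst (M <_) (sym L≡) (n<1+n M)
        N'<N : N' < N
        N'<N = subst (N' <_) (sym N≡) (n<1+n N')
        bMN' : Box M N'
        bMN' = 1≤M , μM<N' , ≤-trans (<⇒≤ N'<N) (≤-reflexive (sym (penultimate-row-full L≡ dom)))
        bMN : Box M N
        bMN = 1≤M , <-trans μM<N' N'<N , ≤-reflexive (sym (penultimate-row-full L≡ dom))
        not-below-top : ¬ 1 < M
        not-below-top 1<M with N' ≤? lam L
        ... | yes N'≤λL = no-B 1<M M<L N'<N top-right bMN' bMN (L≥1 , subst (_< N') (sym mu-L≡0) 1≤N' , N'≤λL)
        ... | no N'≰λL  = no-F 1<M M<L (≤-<-trans (≤lam bottom-left) (≰⇒> N'≰λL)) N'<N top-right bMN' bMN bottom-left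
        two-rows : 1 < M ⊎ M ≡ 1 → diagram s ≐ box2x2
        two-rows (inj₁ 1<M) = ⊥-elim (not-below-top 1<M)
        two-rows (inj₂ M≡1) = two-columns (≤-split 1≤N')
          where
            L≡2 : L ≡ 2
            L≡2 = trans L≡ (cong suc M≡1)
            b₂₁ : Box 2 1
            b₂₁ = subst (λ x → Box x 1) L≡2 bottom-left
            b₂N : Box 2 N
            b₂N = subst (λ x → Box (suc x) N) (≤-antisym (subst (i ≤_) M≡1 i≤M) (row≥1 bᵢ)) bᵢ₊₁
            two-columns : 1 < N' ⊎ N' ≡ 1 → diagram s ≐ box2x2
            two-columns (inj₁ 1<N') = ⊥-elim (no-A (n<1+n 1) 1<N' N'<N (subst (λ x → Box x N') M≡1 bMN')
                                        top-right b₂₁ (convex b₂₁ b₂N ≤-refl ≤-refl 1≤N' (<⇒≤ N'<N)))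
            two-columns (inj₂ N'≡1) = is-box2x2 L≡2 (n<1⇒n≡0 (subst₂ (λ x y → mu x < y) M≡1 N'≡1 μM<N'))
                                        (subst (λ x → mu x ≡ 0) L≡2 mu-L≡0) N≡2
                                        (≤-antisym (≤-trans (lam≤N (s≤s z≤n)) (≤-reflexive N≡2)) (subst (_≤ lam 2) N≡2 (≤lam b₂N)))
              where N≡2 = trans N≡ (cong suc N'≡1)

    -- If all rows above the last start at column c or later, column c is occupied only by the
    -- last row, which therefore reaches c.
    last-row-reaches : ∀ {c} → 1 ≤ c → c ≤ N → (∀ x → 1 ≤ x → x < L → c ≤ mu x) → c ≤ lam L
    last-row-reaches 1≤c c≤N starts-after with column-nonempty 1≤c c≤N
    ... | x , b with ≤-split (row≤L b)
    ...   | inj₁ x<L = ⊥-elim (<⇒≱ (mu< b) (starts-after x (row≥1 b) x<L))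
    ...   | inj₂ L≡x = subst (λ x → _ ≤ lam x) (sym L≡x) (≤lam b)

    reverse-hook : ∀ {i N' M} → N ≡ suc N' → 1 ≤ N' → L ≡ suc M → Domino i N → N' ≤ mu M →
      (diagram s ≐ revHook N L) ⊎ (diagram s ≐ revHookFull N L)
    reverse-hook {i} {N'} {M} N≡ 1≤N' L≡ dom N'≤μM = shape (lam L ≟ N)
      where
        N'≤mu : ∀ x → 1 ≤ x → x < L → N' ≤ mu x
        N'≤mu x 1≤x x<L = ≤-trans N'≤μM (mu-antitone 1≤x (≤-pred (subst (x <_) L≡ x<L)))
        mu-high : ∀ x → 1 ≤ x → x < L → mu x ≡ N'
        mu-high x 1≤x x<L = ≤-antisym
          (≤-pred (subst (mu x <_) (trans (lam-high L≡ dom x 1≤x x<L) N≡) (row-nonempty 1≤x (<⇒≤ x<L))))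
          (N'≤mu x 1≤x x<L)
        open LastColumn N' N≡ mu-high (lam-high L≡ dom) mu-L≡0
        shape : Dec (lam L ≡ N) → (diagram s ≐ revHook N L) ⊎ (diagram s ≐ revHookFull N L)
        shape (yes λL≡N) = inj₂ (is-revHookFull λL≡N)
        shape (no λL≢N)  = inj₁ (is-revHook (≤-antisym
          (≤-pred (subst (lam L <_) N≡ (≤∧≢⇒< (lam≤N L≥1) λL≢N)))
          (last-row-reaches 1≤N' (subst (N' ≤_) (sym N≡) (n≤1+n N')) N'≤mu)))

    last-column-domino : ∀ {i N' M} → N ≡ suc N' → 1 ≤ N' → L ≡ suc M → Domino i N → SpecialShape (diagram s)
    last-column-domino {N' = N'} {M} N≡ 1≤N' L≡ dom with N' ≤? mu M
    ... | no N'≰μM = inj₁ (early-penultimate-start N≡ 1≤N' L≡ dom (≰⇒> N'≰μM))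
    ... | yes N'≤μM = inj₂ (inj₂ (N , L , N≥1 , L≥1 , reverse-hook N≡ 1≤N' L≡ dom N'≤μM))

    -- Conclusion for any domino; if N = 1 the last column is the first.
    domino-shape : ∀ {i j} → Domino i j → SpecialShape (diagram s)
    domino-shape {i} dom with domino-column dom
    ... | inj₁ refl = first-column-domino dom
    ... | inj₂ refl with ≤-split N≥1
    ...   | inj₂ N≡1 = first-column-domino (subst (Domino i) N≡1 dom)
    ...   | inj₁ 1<N with predecessor (<⇒≤ 1<N) | predecessor L≥1
    ...     | N' , N≡ | M , L≡ = last-column-domino N≡ (≤-pred (subst (1 <_) N≡ 1<N)) L≡ dom

  -- Either two consecutive rows share a column, or no column holds two boxes: a box above
  -- another in the same column yields, by convexity, one directly below it.
  domino-or-disjoint : (∃ λ i → ∃ λ j → Domino i j) ⊎ DisjointRows (diagram s)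
  domino-or-disjoint with anyUpTo? (λ m → mu (suc m) <? lam (suc (suc m))) L
  ... | yes (m , _ , μ<λ) = inj₁ (suc m , lam (suc (suc m)) , upper , lower)
    where
      upper : Box (suc m) (lam (suc (suc m)))
      upper = s≤s z≤n , μ<λ , lam-antitone (s≤s z≤n) (n≤1+n (suc m))
      lower : Box (suc (suc m)) (lam (suc (suc m)))
      lower = s≤s z≤n , ≤-<-trans (mu-antitone (s≤s z≤n) (n≤1+n (suc m))) μ<λ , ≤-refl
  ... | no no-μ<λ = inj₂ disjoint
    where
      stacked : ∀ {a c y} → a < c → Box a y → Box c y → ⊥
      stacked {suc m} a<c ba bc = no-μ<λ (m , ≤-trans (n≤1+n (suc m)) (row≤L next) , <-≤-trans (mu< ba) (≤lam next))
        where next = convex ba bc (n≤1+n (suc m)) a<c ≤-refl ≤-refl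
      disjoint : DisjointRows (diagram s)
      disjoint a c y ba bc with <-cmp a c
      ... | tri< a<c _ _ = ⊥-elim (stacked a<c ba bc)
      ... | tri≈ _ a≡c _ = a≡c
      ... | tri> _ _ c<a = ⊥-elim (stacked c<a bc ba)

  classification : DisjointRows (diagram s) ⊎ SpecialShape (diagram s)
  classification with domino-or-disjoint
  ... | inj₂ disjoint                   = inj₁ disjoint
  ... | inj₁ (_ , _ , dom@(_ , lower)) = inj₂ (domino-shape (≤-trans (s≤s z≤n) (row≤L lower)) dom)

mainTheorem16 : (s : SkewShape) → NoEmptyRowsCols s →
    ¬ (⟦ patA ⟧ ⊑ diagram s) → ¬ (⟦ patB ⟧ ⊑ diagram s) → ¬ (⟦ patC ⟧ ⊑ diagram s) →
    ¬ (⟦ patD ⟧ ⊑ diagram s) → ¬ (⟦ patE ⟧ ⊑ diagram s) → ¬ (⟦ patF ⟧ ⊑ diagram s) →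
    ¬ (⟦ patG ⟧ ⊑ diagram s) →
    (∀ r → 4 ≤ r → ¬ (⟦ patH r ⟧ ⊑ diagram s)) →
    (∀ r → 4 ≤ r → ¬ (⟦ patI r ⟧ ⊑ diagram s)) →
    (∀ r → 4 ≤ r → ¬ (⟦ patJ r ⟧ ⊑ diagram s)) →
    DisjointRows (diagram s)
    ⊎ (diagram s ≐ box2x2)
    ⊎ (Σ ℕ λ h → Σ ℕ λ l → (1 ≤ h) × (1 ≤ l) × ((diagram s ≐ hook h l) ⊎ (diagram s ≐ hookFull h l)))
    ⊎ (Σ ℕ λ c → Σ ℕ λ l → (1 ≤ c) × (1 ≤ l) × ((diagram s ≐ revHook c l) ⊎ (diagram s ≐ revHookFull c l)))
mainTheorem16 s ne nA nB nC nD nE nF nG nH nI nJ =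
  Classification.classification s ne nA nB nC nD nE nF nG (nH 4 ≤-refl) (nI 4 ≤-refl) (nJ 4 ≤-refl)
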